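{- Let $\mathcal{R}$ be a commutative ring with unity, $k\in\mathbb{N}$, and let $\mathcal{I}_1,\ldots,\mathcal{I}_{2k}$ be mutually co-maximal ideals of $\mathcal{R}$ such that either $\mathcal{I}=\prod_{i=1}^{2k}\mathcal{I}_i$ satisfies the unital set condition (USC) or $\mathcal{I}=\mathcal{R}$. Let $m^i_j\in\mathbb{N}$ for $1\le i,j\le 2k$. Then the map \[SP_{2k}(\mathcal{R})\longrightarrow\prod_{i=1}^{2k}\mathbb{PF}^{2k-1,(m^i_1,\ldots,m^i_{2k})}_{\mathcal{I}_i},\qquad [a_{i,j}]_{1\le i,j\le 2k}\mapsto\big([a_{1,1}:\cdots:a_{1,2k}],\ldots,[a_{2k,1}:\cdots:a_{2k,2k}]\big)\] is surjective.
   Context: $SP_{2k}(\mathcal{R})=\{A\in M_{2k\times2k}(\mathcal{R})\mid A^tJA=J\}$ with $J=\begin{pmatrix}0&I_k\\-I_k&0\end{pmatrix}$. For $n\in\mathbb{N}$, $\mathcal{GCD}_{n+1}(\mathcal{R})=\{(a_0,\ldots,a_n)\in\mathcal{R}^{n+1}\mid\sum_i\langle a_i\rangle=\mathcal{R}\}$. For an ideal $\mathcal{J}\subsetneq\mathcal{R}$ and exponents $m_0,\ldots,m_n\in\mathbb{N}$, two tuples are equivalent if there is $\lambda\in\mathcal{R}$ with image a unit in $\mathcal{R}/\mathcal{J}$ such that $a_i\equiv\lambda^{m_i}b_i\bmod\mathcal{J}$ for all $i$; $\mathbb{PF}^{n,(m_0,\ldots,m_n)}_{\mathcal{J}}$ is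 the set of classes, written $[a_0:\cdots:a_n]$. If $\mathcal{J}=\mathcal{R}$ all tuples are equivalent (a singleton). A finite subset of $\mathcal{R}$ is unital if it generates the unit ideal. An ideal $\mathcal{J}\subsetneq\mathcal{R}$ satisfies the USC if for every $n\ge2$ and every unital set $\{a_1,\ldots,a_n\}$ there exists $b\in\langle a_2,\ldots,a_n\rangle$ with $a_1+b$ a unit modulo $\mathcal{J}$. -}

module Defs where

open import Level using (Level; _⊔_)
open import Algebra.Bundles using (CommutativeRing)
open import Data.Nat as ℕ using (ℕ; zero; suc)
open import Data.Fin using (Fin; zero; suc; splitAt)
open import Data.Fin.Properties using (_≟_)
open import Data.Sum using (_⊎_; inj₁; inj₂)
open import Data.Product using (Σ; ∃; _×_; _,_)
open import Relation.Nullary using (¬_; yes; no)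
open import Relation.Binary.PropositionalEquality using (_≡_; _≢_)

module _ {c ℓ : Level} (R : CommutativeRing c ℓ) where
  open CommutativeRing R hiding (zero)

  ∑ : (n : ℕ) → (Fin n → Carrier) → Carrier
  ∑ zero    f = 0#
  ∑ (suc n) f = f zero + ∑ n (λ i → f (suc i))

  pow : Carrier → ℕ → Carrier
  pow x zero    = 1#
  pow x (suc m) = x * pow x m

  prodF : (n : ℕ) → (Fin n → Carrier) → Carrier
  prodF zero    f = 1#
  prodF (suc n) f = f zero * prodF n (λ i → f (suc i))

  record Ideal (ℓ' : Level) : Set (c ⊔ ℓ ⊔ Level.suc ℓ') where
    field
      _∈I     : Carrier → Set ℓ'
      ∈-resp  : ∀ {x y} → x ≈ y → x ∈I → y ∈I
      0∈      : 0# ∈I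
      +-closed : ∀ {x y} → x ∈I → y ∈I → (x + y) ∈I
      *-closed : ∀ r {x} → x ∈I → (r * x) ∈I

  Comaximal : ∀ {ℓ'} → Ideal ℓ' → Ideal ℓ' → Set (c ⊔ ℓ ⊔ ℓ')
  Comaximal I J = ∃ λ (a : Carrier) → ∃ λ (b : Carrier) → Ideal._∈I I a × Ideal._∈I J b × (a + b ≈ 1#)

  data ProdMem {ℓ'} {n : ℕ} (I : Fin n → Ideal ℓ') : Carrier → Set (c ⊔ ℓ ⊔ ℓ') where
    gen   : (x : Fin n → Carrier) → (∀ i → Ideal._∈I (I i) (x i)) →
            ProdMem I (prodF n x)
    zero∈ : ProdMem I 0#
    plus  : ∀ {x y} → ProdMem I x → ProdMem I y → ProdMem I (x + y)
    mult  : ∀ r {x} → ProdMem I x → ProdMem I (r * x)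
    resp  : ∀ {x y} → x ≈ y → ProdMem I x → ProdMem I y

  _≡_mod_ : ∀ {ℓ'} → Carrier → Carrier → (Carrier → Set ℓ') → Set ℓ'
  x ≡ y mod J = J (x - y)

  UnitMod : ∀ {ℓ'} → (Carrier → Set ℓ') → Carrier → Set (c ⊔ ℓ')
  UnitMod J u = ∃ λ (v : Carrier) → (u * v) ≡ 1# mod J

  Unital : (n : ℕ) → (Fin n → Carrier) → Set (c ⊔ ℓ)
  Unital n a = ∃ λ (r : Fin n → Carrier) → ∑ n (λ i → r i * a i) ≈ 1#

  InSpan : (n : ℕ) → (Fin n → Carrier) → Carrier → Set (c ⊔ ℓ)
  InSpan n a b = ∃ λ (r : Fin n → Carrier) → b ≈ ∑ n (λ i → r i * a i)

  USC : ∀ {ℓ'} → (Carrier → Set ℓ') → Set (c ⊔ ℓ ⊔ ℓ')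
  USC J = (¬ J 1#) ×
    (∀ (n : ℕ) (a : Fin (suc (suc n)) → Carrier) → Unital (suc (suc n)) a →
       ∃ λ (b : Carrier) → InSpan (suc n) (λ i → a (suc i)) b × UnitMod J (a zero + b))

  GCDTuple : (n : ℕ) → (Fin n → Carrier) → Set (c ⊔ ℓ)
  GCDTuple = Unital

  PFEquiv : ∀ {ℓ'} {n : ℕ} → (Carrier → Set ℓ') → (Fin n → ℕ) →
            (Fin n → Carrier) → (Fin n → Carrier) → Set (c ⊔ ℓ')
  PFEquiv J m a b = ∃ λ (λ' : Carrier) → UnitMod J λ' × (∀ i → a i ≡ pow λ' (m i) * b i mod J)

  Matrix : ℕ → Set c
  Matrix n = Fin n → Fin n → Carrier

  _ᵗ : ∀ {n} → Matrix n → Matrix n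
  (A ᵗ) i j = A j i

  _⊗_ : ∀ {n} → Matrix n → Matrix n → Matrix n
  _⊗_ {n} A B i j = ∑ n (λ l → A i l * B l j)

  _≈M_ : ∀ {n} → Matrix n → Matrix n → Set ℓ
  A ≈M B = ∀ i j → A i j ≈ B i j

  -- J = [[0, I_k], [-I_k, 0]]  of size (k + k)
  Jmat : (k : ℕ) → Matrix (k ℕ.+ k)
  Jmat k i j with splitAt k i | splitAt k j
  ... | inj₁ a | inj₂ b with a ≟ b
  ...   | yes _ = 1#
  ...   | no  _ = 0#
  Jmat k i j | inj₂ a | inj₁ b with a ≟ b
  ...   | yes _ = - 1#
  ...   | no  _ = 0#
  Jmat k i j | inj₁ _ | inj₁ _ = 0#
  Jmat k i j | inj₂ _ | inj₂ _ = 0#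

  IsSymplectic : (k : ℕ) → Matrix (k ℕ.+ k) → Set ℓ
  IsSymplectic k A = (((A ᵗ) ⊗ Jmat k) ⊗ A) ≈M Jmat k

{-# OPTIONS --safe #-}
-- A symplectic transvection T(d, ρ) = 1 + ρ (J d) dᵀ acts on row vectors by
-- x ↦ x + ρ ω(x, d) d, so T(y - x, ρ) carries x to y modulo an ideal I as soon
-- as ρ ω(x, y) ≡ 1 mod I. For the i-th target row v, pick a covector g with g_i = 1
-- and g · v a unit modulo I_i (this is exactly what the unital set condition
-- provides, and is trivial when ∏ I_j = R); with z = J g one has ω(e_i, z) = -1
-- and ω(z, v) = g · v, so two transvections move e_i to z and z to v modulo I_i.
-- Scaling them by an element e ≡ 1 mod I_i lying in every other I_j (a product of
-- comaximality witnesses) makes them ≡ 1 modulo the other ideals. The product of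
-- the 2k matrices so obtained is symplectic and its i-th row is ≡ v_i mod I_i for
-- every i, which gives each class [v_i] with λ = 1.

module Submission where

open import Defs hiding (_ᵗ; _⊗_; _≈M_)
import Defs
open import Level using (Level; 0ℓ; _⊔_)
open import Algebra.Bundles using (CommutativeRing; RawRing)
open import Algebra.Solver.Ring.AlmostCommutativeRing
  using (fromCommutativeRing; _-Raw-AlmostCommutative⟶_)
open import Data.Nat as ℕ using (ℕ; zero; suc)
import Data.Nat.Properties as ℕ
open import Data.Fin using (Fin; zero; suc; _↑ˡ_; _↑ʳ_; punchIn)
open import Data.Fin.Properties using (_≟_; suc-injective; splitAt-↑ˡ; splitAt-↑ʳ)
open import Data.Vec.Functional using (Vector; _∷_; removeAt; insertAt; _++_)
import Data.Vec.Functional.Relation.Binary.Pointwise.Properties as PW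
open import Relation.Binary.Bundles using (Setoid)
open import Data.Vec.Functional.Properties using (insertAt-lookup; insertAt-punchIn; lookup-++ˡ; lookup-++ʳ)
open import Data.Bool using (if_then_else_)
open import Data.Maybe using (Maybe; just; nothing)
open import Data.Product using (∃; _×_; _,_; proj₁; proj₂; map₂)
open import Data.Sum using (_⊎_; inj₁; inj₂)
open import Function using (_∘_)
open import Relation.Nullary using (yes; no; does; contradiction)
open import Relation.Binary.PropositionalEquality as ≡ using (_≡_; _≢_)

module _ {c ℓ : Level} (R : CommutativeRing c ℓ) where
  open CommutativeRing R hiding (zero)
  open import Algebra.Properties.Ring ring using (-‿distribˡ-*; -‿distribʳ-*; -1*x≈-x)
  open import Algebra.Properties.AbelianGroup +-abelianGroup using (⁻¹-anti-homo‿-; ⁻¹-∙-comm; ε⁻¹≈ε; ⁻¹-involutive)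
  open import Algebra.Properties.CommutativeSemigroup +-commutativeSemigroup using (interchange)
  open import Algebra.Properties.Semiring.Mult semiring using (×-homo-+; ×1-homo-*) renaming (_×_ to _×ₙ_)
  open import Algebra.Properties.Semiring.Sum semiring
    using (sum; sum-cong-≋; sum-replicate-zero; *-distribˡ-sum; *-distribʳ-sum; sum-remove)
    renaming (∑-distrib-+ to sum-distrib-+)
  import Relation.Binary.Reasoning.Setoid as Reasoning

  -- Ring normalisation over R with coefficients ℕ × ℕ, the pair (a , b) standing for a - b.
  private
    −-distrib-+ : ∀ a b c d → (a + c) - (b + d) ≈ (a - b) + (c - d)
    −-distrib-+ a b c d = trans (+-congˡ (sym (⁻¹-∙-comm b d))) (interchange a c (- b) (- d))

    −-*-expand : ∀ a b c d → (a * c + b * d) - (a * d + b * c) ≈ (a - b) * (c - d)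
    −-*-expand a b c d = begin
      (a * c + b * d) - (a * d + b * c)       ≈⟨ +-congˡ (sym (⁻¹-∙-comm (a * d) (b * c))) ⟩
      (a * c + b * d) + (- (a * d) - b * c)   ≈⟨ interchange (a * c) (b * d) (- (a * d)) (- (b * c)) ⟩
      (a * c - a * d) + (b * d - b * c)       ≈⟨ +-cong (+-congˡ (-‿distribʳ-* a d)) (+-congˡ (-‿distribʳ-* b c)) ⟩
      (a * c + a * - d) + (b * d + b * - c)   ≈⟨ +-cong (sym (distribˡ a c (- d))) (sym (distribˡ b d (- c))) ⟩
      a * (c - d) + b * (d - c)
        ≈⟨ +-congˡ (trans (*-congˡ (sym (⁻¹-anti-homo‿- c d))) (sym (-‿distribʳ-* b (c - d)))) ⟩
      a * (c - d) + - (b * (c - d))           ≈⟨ +-congˡ (-‿distribˡ-* b (c - d)) ⟩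
      a * (c - d) + - b * (c - d)             ≈⟨ sym (distribʳ (c - d) a (- b)) ⟩
      (a - b) * (c - d)                       ∎
      where open Reasoning setoid

    x-x≈0 : ∀ x → x - x ≈ 0#
    x-x≈0 = -‿inverseʳ

    −-cancel : ∀ a b c d → a + d ≈ b + c → a - b ≈ c - d
    −-cancel a b c d a+d≈b+c = begin
      a - b                ≈⟨ sym (+-identityʳ _) ⟩
      (a - b) + 0#         ≈⟨ +-congˡ (sym (x-x≈0 d)) ⟩
      (a - b) + (d - d)    ≈⟨ sym (−-distrib-+ a b d d) ⟩
      (a + d) - (b + d)    ≈⟨ +-congʳ a+d≈b+c ⟩
      (b + c) - (b + d)    ≈⟨ −-distrib-+ b b c d ⟩
      (b - b) + (c - d)    ≈⟨ trans (+-congʳ (x-x≈0 b)) (+-identityˡ _) ⟩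
      c - d                ∎
      where open Reasoning setoid

    differences : RawRing 0ℓ 0ℓ
    differences = record
      { Carrier = ℕ × ℕ ; _≈_ = _≡_
      ; _+_ = λ (a , b) (c , d) → (a ℕ.+ c , b ℕ.+ d)
      ; _*_ = λ (a , b) (c , d) → (a ℕ.* c ℕ.+ b ℕ.* d , a ℕ.* d ℕ.+ b ℕ.* c)
      ; -_ = λ (a , b) → (b , a)
      ; 0# = (0 , 0) ; 1# = (1 , 0) }

    ⟦_⟧ᵈ : ℕ × ℕ → Carrier
    ⟦ a , b ⟧ᵈ = a ×ₙ 1# - b ×ₙ 1#

    ×1-homo-*+ : ∀ a b c d → (a ℕ.* c ℕ.+ b ℕ.* d) ×ₙ 1# ≈ a ×ₙ 1# * c ×ₙ 1# + b ×ₙ 1# * d ×ₙ 1#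
    ×1-homo-*+ a b c d = trans (×-homo-+ 1# (a ℕ.* c) (b ℕ.* d)) (+-cong (×1-homo-* a c) (×1-homo-* b d))

    ⟦⟧ᵈ-homomorphism : differences -Raw-AlmostCommutative⟶ fromCommutativeRing R
    ⟦⟧ᵈ-homomorphism = record
      { ⟦_⟧    = ⟦_⟧ᵈ
      ; +-homo = λ (a , b) (c , d) →
          trans (+-cong (×-homo-+ 1# a c) (-‿cong (×-homo-+ 1# b d))) (−-distrib-+ _ _ _ _)
      ; *-homo = λ (a , b) (c , d) →
          trans (+-cong (×1-homo-*+ a b c d) (-‿cong (×1-homo-*+ a b d c))) (−-*-expand _ _ _ _)
      ; -‿homo = λ (a , b) → sym (⁻¹-anti-homo‿- (a ×ₙ 1#) (b ×ₙ 1#))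
      ; 0-homo = x-x≈0 0#
      ; 1-homo = trans (+-cong (+-identityʳ 1#) ε⁻¹≈ε) (+-identityʳ 1#)
      }

    ⟦⟧ᵈ-≟ : ∀ x y → Maybe (⟦ x ⟧ᵈ ≈ ⟦ y ⟧ᵈ)
    ⟦⟧ᵈ-≟ (a , b) (c , d) with a ℕ.+ d ℕ.≟ b ℕ.+ c
    ... | yes a+d≡b+c = just (−-cancel _ _ _ _
            (trans (sym (×-homo-+ 1# a d)) (trans (reflexive (≡.cong (_×ₙ 1#) a+d≡b+c)) (×-homo-+ 1# b c))))
    ... | no _ = nothing

  open import Algebra.Solver.Ring differences (fromCommutativeRing R) ⟦⟧ᵈ-homomorphism ⟦⟧ᵈ-≟
    using (solve; _:+_; _:*_; :-_; _:-_; _:=_)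

  ∑≡sum : ∀ n (f : Vector Carrier n) → ∑ R n f ≡ sum f
  ∑≡sum zero    f = ≡.refl
  ∑≡sum (suc n) f = ≡.cong (f zero +_) (∑≡sum n (f ∘ suc))

  ∑-cong : ∀ n {f g : Vector Carrier n} → (∀ i → f i ≈ g i) → ∑ R n f ≈ ∑ R n g
  ∑-cong n {f} {g} f≈g rewrite ∑≡sum n f | ∑≡sum n g = sum-cong-≋ f≈g

  ∑-zero : ∀ n {f : Vector Carrier n} → (∀ i → f i ≈ 0#) → ∑ R n f ≈ 0#
  ∑-zero n f≈0 = trans (∑-cong n f≈0) (trans (reflexive (∑≡sum n _)) (sum-replicate-zero n))

  ∑-distrib-+ : ∀ n (f g : Vector Carrier n) → ∑ R n (λ i → f i + g i) ≈ ∑ R n f + ∑ R n g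
  ∑-distrib-+ n f g rewrite ∑≡sum n (λ i → f i + g i) | ∑≡sum n f | ∑≡sum n g = sum-distrib-+ f g

  *-distribˡ-∑ : ∀ n x (f : Vector Carrier n) → x * ∑ R n f ≈ ∑ R n (λ i → x * f i)
  *-distribˡ-∑ n x f rewrite ∑≡sum n f | ∑≡sum n (λ i → x * f i) = *-distribˡ-sum x f

  *-distribʳ-∑ : ∀ n x (f : Vector Carrier n) → ∑ R n f * x ≈ ∑ R n (λ i → f i * x)
  *-distribʳ-∑ n x f rewrite ∑≡sum n f | ∑≡sum n (λ i → f i * x) = *-distribʳ-sum x f

  -‿distrib-∑ : ∀ n (f : Vector Carrier n) → - ∑ R n f ≈ ∑ R n (λ i → - f i)
  -‿distrib-∑ n f = begin
    - ∑ R n f                  ≈⟨ sym (-1*x≈-x _) ⟩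
    - 1# * ∑ R n f             ≈⟨ *-distribˡ-∑ n (- 1#) f ⟩
    ∑ R n (λ i → - 1# * f i)   ≈⟨ ∑-cong n (λ i → -1*x≈-x (f i)) ⟩
    ∑ R n (λ i → - f i)        ∎
    where open Reasoning setoid

  ∑-comm : ∀ m n (f : Fin m → Fin n → Carrier) →
           ∑ R m (λ i → ∑ R n (f i)) ≈ ∑ R n (λ j → ∑ R m (λ i → f i j))
  ∑-comm zero    n f = sym (∑-zero n (λ _ → refl))
  ∑-comm (suc m) n f = trans (+-congˡ (∑-comm m n (f ∘ suc))) (sym (∑-distrib-+ n (f zero) _))

  ∑-++ : ∀ m n (f : Vector Carrier (m ℕ.+ n)) →
         ∑ R (m ℕ.+ n) f ≈ ∑ R m (λ i → f (i ↑ˡ n)) + ∑ R n (λ j → f (m ↑ʳ j))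
  ∑-++ zero    n f = sym (+-identityˡ _)
  ∑-++ (suc m) n f = trans (+-congˡ (∑-++ m n (f ∘ suc))) (sym (+-assoc _ _ _))

  ∑-remove : ∀ n (f : Vector Carrier (suc n)) i → ∑ R (suc n) f ≈ f i + ∑ R n (removeAt f i)
  ∑-remove n f i rewrite ∑≡sum (suc n) f | ∑≡sum n (removeAt f i) = sum-remove f

  ∑-affine : ∀ n (f g h : Vector Carrier n) b a →
             ∑ R n (λ i → f i + (b * g i - a * h i)) ≈ ∑ R n f + (b * ∑ R n g - a * ∑ R n h)
  ∑-affine n f g h b a = begin
    ∑ R n (λ i → f i + (b * g i - a * h i))                   ≈⟨ ∑-distrib-+ n f _ ⟩
    ∑ R n f + ∑ R n (λ i → b * g i - a * h i)                 ≈⟨ +-congˡ (∑-distrib-+ n _ _) ⟩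
    ∑ R n f + (∑ R n (λ i → b * g i) + ∑ R n (λ i → - (a * h i)))
      ≈⟨ +-congˡ (+-cong (sym (*-distribˡ-∑ n b g)) (sym (-‿distrib-∑ n _))) ⟩
    ∑ R n f + (b * ∑ R n g - ∑ R n (λ i → a * h i))
      ≈⟨ +-congˡ (+-congˡ (-‿cong (sym (*-distribˡ-∑ n a h)))) ⟩
    ∑ R n f + (b * ∑ R n g - a * ∑ R n h)                     ∎
    where open Reasoning setoid

  δ : ∀ {n} → Fin n → Fin n → Carrier
  δ i j = if does (i ≟ j) then 1# else 0#

  δ-refl : ∀ {n} (i : Fin n) → δ i i ≈ 1#
  δ-refl i with i ≟ i
  ... | yes _   = refl
  ... | no i≢i = contradiction ≡.refl i≢i

  δ-sym : ∀ {n} (i j : Fin n) → δ i j ≈ δ j i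
  δ-sym i j with i ≟ j | j ≟ i
  ... | yes _   | yes _   = refl
  ... | no _    | no _    = refl
  ... | yes i≡j | no j≢i  = contradiction (≡.sym i≡j) j≢i
  ... | no i≢j  | yes j≡i = contradiction (≡.sym j≡i) i≢j

  ∑-δˡ : ∀ n (i : Fin n) (f : Vector Carrier n) → ∑ R n (λ j → δ i j * f j) ≈ f i
  ∑-δˡ (suc n) zero    f = trans (+-cong (*-identityˡ _) (∑-zero n (λ _ → zeroˡ _))) (+-identityʳ _)
  ∑-δˡ (suc n) (suc i) f = trans (+-cong (zeroˡ _) (∑-δˡ n i (f ∘ suc))) (+-identityˡ _)

  ∑-δʳ : ∀ n (i : Fin n) (f : Vector Carrier n) → ∑ R n (λ j → f j * δ j i) ≈ f i
  ∑-δʳ n i f = trans (∑-cong n (λ j → trans (*-comm _ _) (*-congʳ (δ-sym j i)))) (∑-δˡ n i f)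

  _ᵗ : ∀ {n} → Matrix R n → Matrix R n
  _ᵗ = Defs._ᵗ R

  infixl 7 _⊗_
  _⊗_ : ∀ {n} → Matrix R n → Matrix R n → Matrix R n
  _⊗_ = Defs._⊗_ R

  infix 4 _≈M_
  _≈M_ : ∀ {n} → Matrix R n → Matrix R n → Set ℓ
  _≈M_ = Defs._≈M_ R

  Id : ∀ {n} → Matrix R n
  Id = δ

  infixl 7 _⊙_
  _⊙_ : ∀ {n} → Vector Carrier n → Matrix R n → Vector Carrier n
  _⊙_ {n} x A q = ∑ R n (λ p → x p * A p q)

  infixl 7 _·_
  _·_ : ∀ {n} → Vector Carrier n → Vector Carrier n → Carrier
  _·_ {n} x y = ∑ R n (λ l → x l * y l)

  matrixSetoid : ℕ → Setoid c ℓ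
  matrixSetoid n = PW.setoid (PW.setoid setoid n) n

  ⊗-cong : ∀ {n} {A A′ B B′ : Matrix R n} → A ≈M A′ → B ≈M B′ → (A ⊗ B) ≈M (A′ ⊗ B′)
  ⊗-cong {n} A≈A′ B≈B′ p q = ∑-cong n (λ l → *-cong (A≈A′ p l) (B≈B′ l q))

  ⊗-assoc : ∀ {n} (A B C : Matrix R n) → ((A ⊗ B) ⊗ C) ≈M (A ⊗ (B ⊗ C))
  ⊗-assoc {n} A B C p q = begin
    ∑ R n (λ l → ∑ R n (λ m → A p m * B m l) * C l q)   ≈⟨ ∑-cong n (λ l → *-distribʳ-∑ n (C l q) _) ⟩
    ∑ R n (λ l → ∑ R n (λ m → A p m * B m l * C l q))   ≈⟨ ∑-comm n n _ ⟩
    ∑ R n (λ m → ∑ R n (λ l → A p m * B m l * C l q))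
      ≈⟨ ∑-cong n (λ m → trans (∑-cong n (λ l → *-assoc _ _ _)) (sym (*-distribˡ-∑ n (A p m) _))) ⟩
    ∑ R n (λ m → A p m * ∑ R n (λ l → B m l * C l q))   ∎
    where open Reasoning setoid

  ᵗ-⊗ : ∀ {n} (A B : Matrix R n) → ((A ⊗ B) ᵗ) ≈M ((B ᵗ) ⊗ (A ᵗ))
  ᵗ-⊗ {n} A B p q = ∑-cong n (λ l → *-comm _ _)

  ⊗-identityˡ : ∀ {n} (A : Matrix R n) → (Id ⊗ A) ≈M A
  ⊗-identityˡ {n} A p q = ∑-δˡ n p (λ l → A l q)

  ⊗-identityʳ : ∀ {n} (A : Matrix R n) → (A ⊗ Id) ≈M A
  ⊗-identityʳ {n} A p q = ∑-δʳ n q (A p)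

  ∏ : ∀ {n} m → (Fin m → Matrix R n) → Matrix R n
  ∏ zero    F = Id
  ∏ (suc m) F = F zero ⊗ ∏ m (F ∘ suc)

  module Modulo {ℓ′ : Level} (I : Ideal R ℓ′) where
    open Ideal I

    infix 4 _≋_ _≋M_
    _≋_ : Carrier → Carrier → Set ℓ′
    x ≋ y = _≡_mod_ R x y _∈I

    _≋M_ : ∀ {n} → Matrix R n → Matrix R n → Set ℓ′
    A ≋M B = ∀ p q → A p q ≋ B p q

    ≈⇒≋ : ∀ {x y} → x ≈ y → x ≋ y
    ≈⇒≋ {x} {y} x≈y = ∈-resp (sym (trans (+-congʳ x≈y) (x-x≈0 y))) 0∈

    ≋-refl : ∀ {x} → x ≋ x
    ≋-refl = ≈⇒≋ refl

    ≋-sym : ∀ {x y} → x ≋ y → y ≋ x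
    ≋-sym {x} {y} x≋y = ∈-resp (trans (-1*x≈-x _) (⁻¹-anti-homo‿- x y)) (*-closed (- 1#) x≋y)

    ≋-trans : ∀ {x y z} → x ≋ y → y ≋ z → x ≋ z
    ≋-trans {x} {y} {z} x≋y y≋z = ∈-resp (telescope x y z) (+-closed x≋y y≋z)
      where
      telescope : ∀ x y z → (x - y) + (y - z) ≈ x - z
      telescope = solve 3 (λ x y z → (x :- y) :+ (y :- z) := x :- z) refl

    ≋-setoid : Setoid c ℓ′
    ≋-setoid = record { Carrier = Carrier ; _≈_ = _≋_
                      ; isEquivalence = record { refl = ≋-refl ; sym = ≋-sym ; trans = ≋-trans } }

    +-cong-≋ : ∀ {x x′ y y′} → x ≋ x′ → y ≋ y′ → x + y ≋ x′ + y′
    +-cong-≋ x≋x′ y≋y′ = ∈-resp (sym (−-distrib-+ _ _ _ _)) (+-closed x≋x′ y≋y′)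

    *-cong-≋ : ∀ {x x′ y y′} → x ≋ x′ → y ≋ y′ → x * y ≋ x′ * y′
    *-cong-≋ {x} {x′} {y} {y′} x≋x′ y≋y′ =
      ∈-resp (expand x x′ y y′) (+-closed (*-closed y x≋x′) (*-closed x′ y≋y′))
      where
      expand : ∀ x x′ y y′ → y * (x - x′) + x′ * (y - y′) ≈ x * y - x′ * y′
      expand = solve 4 (λ x x′ y y′ → y :* (x :- x′) :+ x′ :* (y :- y′) := x :* y :- x′ :* y′) refl

    ∑-cong-≋ : ∀ n {f g : Vector Carrier n} → (∀ i → f i ≋ g i) → ∑ R n f ≋ ∑ R n g
    ∑-cong-≋ zero    f≋g = ≋-refl
    ∑-cong-≋ (suc n) f≋g = +-cong-≋ (f≋g zero) (∑-cong-≋ n (f≋g ∘ suc))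

    ⊙-cong-≋ : ∀ {n} {x y : Vector Carrier n} (A : Matrix R n) → (∀ p → x p ≋ y p) → ∀ q → (x ⊙ A) q ≋ (y ⊙ A) q
    ⊙-cong-≋ {n} A x≋y q = ∑-cong-≋ n (λ p → *-cong-≋ (x≋y p) ≋-refl)

    ⊗-cong-≋ : ∀ {n} {A A′ B B′ : Matrix R n} → A ≋M A′ → B ≋M B′ → A ⊗ B ≋M A′ ⊗ B′
    ⊗-cong-≋ {n} A≋A′ B≋B′ p q = ∑-cong-≋ n (λ l → *-cong-≋ (A≋A′ p l) (B≋B′ l q))

    ∏-≋-Id : ∀ {n} m (F : Fin m → Matrix R n) → (∀ j → F j ≋M Id) → ∏ m F ≋M Id
    ∏-≋-Id zero    F F≋Id p q = ≋-refl
    ∏-≋-Id (suc m) F F≋Id p q =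
      ≋-trans (⊗-cong-≋ (F≋Id zero) (∏-≋-Id m (F ∘ suc) (F≋Id ∘ suc)) p q) (≈⇒≋ (⊗-identityˡ Id p q))

    ∏-≋-single : ∀ {n} m (F : Fin m → Matrix R n) i → (∀ j → j ≢ i → F j ≋M Id) → ∏ m F ≋M F i
    ∏-≋-single (suc m) F zero F≋Id p q =
      ≋-trans (⊗-cong-≋ {A = F zero} (λ _ _ → ≋-refl) (∏-≋-Id m (F ∘ suc) (λ j → F≋Id (suc j) λ ())) p q)
              (≈⇒≋ (⊗-identityʳ (F zero) p q))
    ∏-≋-single (suc m) F (suc i) F≋Id p q =
      ≋-trans (⊗-cong-≋ (F≋Id zero λ ())
                         (∏-≋-single m (F ∘ suc) i (λ j j≢i → F≋Id (suc j) (j≢i ∘ suc-injective))) p q)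
              (≈⇒≋ (⊗-identityˡ (F (suc i)) p q))

  infix 4 _∈_
  _∈_ : ∀ {ℓ′} → Carrier → Ideal R ℓ′ → Set ℓ′
  x ∈ J = Ideal._∈I J x

  prodIdeal : ∀ {ℓ′ n} → (Fin n → Ideal R ℓ′) → Ideal R (c ⊔ ℓ ⊔ ℓ′)
  prodIdeal I = record
    { _∈I = ProdMem R I ; ∈-resp = resp ; 0∈ = zero∈ ; +-closed = plus ; *-closed = mult }

  prodF-∈ : ∀ {ℓ′} (J : Ideal R ℓ′) n (f : Vector Carrier n) j → f j ∈ J → prodF R n f ∈ J
  prodF-∈ J (suc n) f zero    fj∈J = Ideal.∈-resp J (*-comm _ _) (Ideal.*-closed J _ fj∈J)
  prodF-∈ J (suc n) f (suc j) fj∈J = Ideal.*-closed J (f zero) (prodF-∈ J n (f ∘ suc) j fj∈J)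

  ProdMem⊆ : ∀ {ℓ′ n} (I : Fin n → Ideal R ℓ′) j {x} → ProdMem R I x → x ∈ I j
  ProdMem⊆ I j (gen x x∈I)  = prodF-∈ (I j) _ x j (x∈I j)
  ProdMem⊆ I j zero∈        = Ideal.0∈ (I j)
  ProdMem⊆ I j (plus x∈ y∈) = Ideal.+-closed (I j) (ProdMem⊆ I j x∈) (ProdMem⊆ I j y∈)
  ProdMem⊆ I j (mult r x∈)  = Ideal.*-closed (I j) r (ProdMem⊆ I j x∈)
  ProdMem⊆ I j (resp x≈y x∈) = Ideal.∈-resp (I j) x≈y (ProdMem⊆ I j x∈)

  module _ {ℓ′} (J : Ideal R ℓ′) where
    open Modulo J

    prodF-≋1 : ∀ n (f : Vector Carrier n) → (∀ j → f j ≋ 1#) → prodF R n f ≋ 1#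
    prodF-≋1 zero    f f≋1 = ≋-refl
    prodF-≋1 (suc n) f f≋1 =
      ≋-trans (*-cong-≋ (f≋1 zero) (prodF-≋1 n (f ∘ suc) (f≋1 ∘ suc))) (≈⇒≋ (*-identityˡ 1#))

    UnitMod-resp : ∀ {x y} → x ≈ y → UnitMod R (Ideal._∈I J) x → UnitMod R (Ideal._∈I J) y
    UnitMod-resp x≈y (w , xw≋1) = w , ≋-trans (≈⇒≋ (*-congʳ (sym x≈y))) xw≋1

    1∈⇒UnitMod : 1# ∈ J → ∀ x → UnitMod R (Ideal._∈I J) x
    1∈⇒UnitMod 1∈J x = 0# , Ideal.∈-resp J minus-one (Ideal.*-closed J (- 1#) 1∈J)
      where
      minus-one : - 1# * 1# ≈ x * 0# - 1#
      minus-one = trans (*-identityʳ _) (sym (trans (+-congʳ (zeroʳ x)) (+-identityˡ _)))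

  comaximal⇒≋1 : ∀ {ℓ′} (I J : Ideal R ℓ′) → Comaximal R I J → ∃ λ b → Modulo._≋_ I b 1# × b ∈ J
  comaximal⇒≋1 I J (a , b , a∈I , b∈J , a+b≈1) = b , Ideal.∈-resp I -a≈b-1 (Ideal.*-closed I (- 1#) a∈I) , b∈J
    where
    -a≈b-1 : - 1# * a ≈ b - 1#
    -a≈b-1 = trans (-1*x≈-x a) (trans (solve 2 (λ a b → :- a := b :- (a :+ b)) refl a b) (+-congˡ (-‿cong a+b≈1)))

  separator : ∀ {ℓ′ n} (I : Fin n → Ideal R ℓ′) → (∀ i j → i ≢ j → Comaximal R (I i) (I j)) →
              ∀ i → ∃ λ e → Modulo._≋_ (I i) e 1# × (∀ j → j ≢ i → e ∈ I j)
  separator {n = n} I comax i =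
    prodF R n (proj₁ ∘ factor) ,
    prodF-≋1 (I i) n _ (proj₁ ∘ proj₂ ∘ factor) ,
    λ j j≢i → prodF-∈ (I j) n _ j (proj₂ (proj₂ (factor j)) j≢i)
    where
    factor : ∀ j → ∃ λ b → Modulo._≋_ (I i) b 1# × (j ≢ i → b ∈ I j)
    factor j with i ≟ j
    ... | yes ≡.refl = 1# , Modulo.≋-refl (I i) , λ i≢i → contradiction ≡.refl i≢i
    ... | no i≢j with comaximal⇒≋1 (I i) (I j) (comax i j i≢j)
    ...   | b , b≋1 , b∈Ij = b , b≋1 , λ _ → b∈Ij

  USC⇒unitCovector : ∀ {ℓ′} (J : Ideal R ℓ′) → USC R (Ideal._∈I J) →
                 ∀ n (v : Vector Carrier n) → Unital R n v → ∀ i →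
                 ∃ λ g → g i ≈ 1# × UnitMod R (Ideal._∈I J) (g · v)
  -- The condition speaks only of tuples of length ≥ 2; a unital 1-tuple is already a unit.
  -- Otherwise it is applied to v i followed by v with entry i removed, and g inserts 1 at i
  -- into the coefficients it returns.
  USC⇒unitCovector J _ 1 v (r , r·v≈1) zero =
    (λ _ → 1#) , refl , r zero , Modulo.≈⇒≋ J (trans (*-congʳ (trans (+-identityʳ _) (*-identityˡ _)))
                                          (trans (*-comm _ _) (trans (sym (+-identityʳ _)) r·v≈1)))
  USC⇒unitCovector J (_ , usc) (suc (suc m)) v (r , r·v≈1) i
    with usc m (v i ∷ removeAt v i) (r i ∷ removeAt r i , trans (sym (∑-remove (suc m) (λ l → r l * v l) i)) r·v≈1)
  ... | b , (s , b≈s·v) , v+b-unit = g , reflexive (insertAt-lookup s i 1#) , UnitMod-resp J (sym g·v≈v+b) v+b-unit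
    where
    g : Vector Carrier (suc (suc m))
    g = insertAt s i 1#
    g·v≈v+b : g · v ≈ v i + b
    g·v≈v+b = begin
      g · v                                            ≈⟨ ∑-remove (suc m) (λ l → g l * v l) i ⟩
      g i * v i + ∑ R (suc m) (removeAt (λ l → g l * v l) i)
        ≈⟨ +-cong (trans (*-congʳ (reflexive (insertAt-lookup s i 1#))) (*-identityˡ _))
                  (∑-cong (suc m) (λ l → *-congʳ {v (punchIn i l)} (reflexive (insertAt-punchIn s i 1# l)))) ⟩
      v i + ∑ R (suc m) (λ l → s l * v (punchIn i l))  ≈⟨ +-congˡ (sym b≈s·v) ⟩
      v i + b                                          ∎
      where open Reasoning setoid

  module Symplectic (k : ℕ) where
    private
      n : ℕ
      n = k ℕ.+ k

    J : Matrix R n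
    J = Jmat R k

    J-↑ˡ-↑ˡ : ∀ a b → J (a ↑ˡ k) (b ↑ˡ k) ≈ 0#
    J-↑ˡ-↑ˡ a b rewrite splitAt-↑ˡ k a k | splitAt-↑ˡ k b k = refl

    J-↑ʳ-↑ʳ : ∀ a b → J (k ↑ʳ a) (k ↑ʳ b) ≈ 0#
    J-↑ʳ-↑ʳ a b rewrite splitAt-↑ʳ k k a | splitAt-↑ʳ k k b = refl

    J-↑ˡ-↑ʳ : ∀ a b → J (a ↑ˡ k) (k ↑ʳ b) ≈ δ a b
    J-↑ˡ-↑ʳ a b rewrite splitAt-↑ˡ k a k | splitAt-↑ʳ k k b with a ≟ b
    ... | yes _ = refl
    ... | no _  = refl

    J-↑ʳ-↑ˡ : ∀ a b → J (k ↑ʳ a) (b ↑ˡ k) ≈ - δ a b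
    J-↑ʳ-↑ˡ a b rewrite splitAt-↑ʳ k k a | splitAt-↑ˡ k b k with a ≟ b
    ... | yes _ = refl
    ... | no _  = sym ε⁻¹≈ε

    ω : Vector Carrier n → Vector Carrier n → Carrier
    ω x y = ∑ R k (λ a → x (a ↑ˡ k) * y (k ↑ʳ a) - x (k ↑ʳ a) * y (a ↑ˡ k))

    ⊙J-↑ˡ : ∀ x b → (x ⊙ J) (b ↑ˡ k) ≈ - x (k ↑ʳ b)
    ⊙J-↑ˡ x b = begin
      (x ⊙ J) (b ↑ˡ k)                                                   ≈⟨ ∑-++ k k _ ⟩
      ∑ R k (λ a → x (a ↑ˡ k) * J (a ↑ˡ k) (b ↑ˡ k)) + ∑ R k (λ a → x (k ↑ʳ a) * J (k ↑ʳ a) (b ↑ˡ k))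
        ≈⟨ +-cong (∑-zero k (λ a → trans (*-congˡ (J-↑ˡ-↑ˡ a b)) (zeroʳ _)))
                  (∑-cong k (λ a → trans (*-congˡ (J-↑ʳ-↑ˡ a b)) (sym (-‿distribʳ-* _ _)))) ⟩
      0# + ∑ R k (λ a → - (x (k ↑ʳ a) * δ a b))                           ≈⟨ +-identityˡ _ ⟩
      ∑ R k (λ a → - (x (k ↑ʳ a) * δ a b))                                ≈⟨ sym (-‿distrib-∑ k _) ⟩
      - ∑ R k (λ a → x (k ↑ʳ a) * δ a b)                                  ≈⟨ -‿cong (∑-δʳ k b _) ⟩
      - x (k ↑ʳ b)                                                       ∎
      where open Reasoning setoid

    ⊙J-↑ʳ : ∀ x b → (x ⊙ J) (k ↑ʳ b) ≈ x (b ↑ˡ k)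
    ⊙J-↑ʳ x b = begin
      (x ⊙ J) (k ↑ʳ b)                                                   ≈⟨ ∑-++ k k _ ⟩
      ∑ R k (λ a → x (a ↑ˡ k) * J (a ↑ˡ k) (k ↑ʳ b)) + ∑ R k (λ a → x (k ↑ʳ a) * J (k ↑ʳ a) (k ↑ʳ b))
        ≈⟨ +-cong (∑-cong k (λ a → *-congˡ (J-↑ˡ-↑ʳ a b)))
                  (∑-zero k (λ a → trans (*-congˡ (J-↑ʳ-↑ʳ a b)) (zeroʳ _))) ⟩
      ∑ R k (λ a → x (a ↑ˡ k) * δ a b) + 0#                               ≈⟨ +-identityʳ _ ⟩
      ∑ R k (λ a → x (a ↑ˡ k) * δ a b)                                    ≈⟨ ∑-δʳ k b _ ⟩
      x (b ↑ˡ k)                                                         ∎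
      where open Reasoning setoid

    ⊙J·≈ω : ∀ x y → (x ⊙ J) · y ≈ ω x y
    ⊙J·≈ω x y = begin
      (x ⊙ J) · y                    ≈⟨ ∑-++ k k _ ⟩
      ∑ R k (λ a → (x ⊙ J) (a ↑ˡ k) * y (a ↑ˡ k)) + ∑ R k (λ a → (x ⊙ J) (k ↑ʳ a) * y (k ↑ʳ a))
        ≈⟨ sym (∑-distrib-+ k _ _) ⟩
      ∑ R k (λ a → (x ⊙ J) (a ↑ˡ k) * y (a ↑ˡ k) + (x ⊙ J) (k ↑ʳ a) * y (k ↑ʳ a))
        ≈⟨ ∑-cong k (λ a → trans (+-cong (*-congʳ (⊙J-↑ˡ x a)) (*-congʳ (⊙J-↑ʳ x a))) (rearrange _ _ _ _)) ⟩
      ω x y                          ∎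
      where
      open Reasoning setoid
      rearrange : ∀ xR yL xL yR → - xR * yL + xL * yR ≈ xL * yR - xR * yL
      rearrange = solve 4 (λ xR yL xL yR → (:- xR) :* yL :+ xL :* yR := xL :* yR :- xR :* yL) refl

    ω-columns : ∀ A p q → (((A ᵗ) ⊗ J) ⊗ A) p q ≈ ω ((A ᵗ) p) ((A ᵗ) q)
    ω-columns A p q = ⊙J·≈ω ((A ᵗ) p) ((A ᵗ) q)

    Id-symplectic : IsSymplectic R k Id
    Id-symplectic p q = begin
      ((Id ᵗ) p ⊙ J) · (λ l → δ l q)     ≈⟨ ∑-δʳ n q _ ⟩
      ((Id ᵗ) p ⊙ J) q                   ≈⟨ ∑-cong n (λ m → *-congʳ (δ-sym m p)) ⟩
      (δ p ⊙ J) q                        ≈⟨ ∑-δˡ n p (λ m → J m q) ⟩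
      J p q                              ∎
      where open Reasoning setoid

    ω-basis : ∀ p q → ω ((Id ᵗ) p) ((Id ᵗ) q) ≈ J p q
    ω-basis p q = trans (sym (ω-columns Id p q)) (Id-symplectic p q)

    ⊗-symplectic : ∀ {A B} → IsSymplectic R k A → IsSymplectic R k B → IsSymplectic R k (A ⊗ B)
    ⊗-symplectic {A} {B} sA sB = begin
      ((A ⊗ B) ᵗ ⊗ J) ⊗ (A ⊗ B)          ≈⟨ ⊗-cong (⊗-cong (ᵗ-⊗ A B) ≈M-refl) ≈M-refl ⟩
      ((B ᵗ ⊗ A ᵗ) ⊗ J) ⊗ (A ⊗ B)        ≈⟨ ⊗-cong (⊗-assoc (B ᵗ) (A ᵗ) J) ≈M-refl ⟩
      (B ᵗ ⊗ (A ᵗ ⊗ J)) ⊗ (A ⊗ B)        ≈⟨ ⊗-assoc (B ᵗ) (A ᵗ ⊗ J) (A ⊗ B) ⟩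
      B ᵗ ⊗ ((A ᵗ ⊗ J) ⊗ (A ⊗ B))        ≈⟨ ⊗-cong ≈M-refl (≈M-sym (⊗-assoc (A ᵗ ⊗ J) A B)) ⟩
      B ᵗ ⊗ (((A ᵗ ⊗ J) ⊗ A) ⊗ B)        ≈⟨ ⊗-cong ≈M-refl (⊗-cong sA ≈M-refl) ⟩
      B ᵗ ⊗ (J ⊗ B)                      ≈⟨ ≈M-sym (⊗-assoc (B ᵗ) J B) ⟩
      (B ᵗ ⊗ J) ⊗ B                      ≈⟨ sB ⟩
      J                                  ∎
      where
      open Reasoning (matrixSetoid n)
      open Setoid (matrixSetoid n) using () renaming (refl to ≈M-refl; sym to ≈M-sym)

    -- The column J d, written out blockwise.
    J⟨_⟩ : Vector Carrier n → Vector Carrier n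
    J⟨ d ⟩ = (λ a → d (k ↑ʳ a)) ++ (λ a → - d (a ↑ˡ k))

    J⟨⟩-↑ˡ : ∀ d a → J⟨ d ⟩ (a ↑ˡ k) ≈ d (k ↑ʳ a)
    J⟨⟩-↑ˡ d a = reflexive (lookup-++ˡ (λ a → d (k ↑ʳ a)) (λ a → - d (a ↑ˡ k)) a)

    J⟨⟩-↑ʳ : ∀ d a → J⟨ d ⟩ (k ↑ʳ a) ≈ - d (a ↑ˡ k)
    J⟨⟩-↑ʳ d a = reflexive (lookup-++ʳ (λ a → d (k ↑ʳ a)) (λ a → - d (a ↑ˡ k)) a)

    ·-J⟨⟩ : ∀ x d → x · J⟨ d ⟩ ≈ ω x d
    ·-J⟨⟩ x d = begin
      x · J⟨ d ⟩                                                               ≈⟨ ∑-++ k k _ ⟩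
      ∑ R k (λ a → x (a ↑ˡ k) * J⟨ d ⟩ (a ↑ˡ k)) + ∑ R k (λ a → x (k ↑ʳ a) * J⟨ d ⟩ (k ↑ʳ a))
        ≈⟨ sym (∑-distrib-+ k _ _) ⟩
      ∑ R k (λ a → x (a ↑ˡ k) * J⟨ d ⟩ (a ↑ˡ k) + x (k ↑ʳ a) * J⟨ d ⟩ (k ↑ʳ a))
        ≈⟨ ∑-cong k (λ a → +-cong (*-congˡ (J⟨⟩-↑ˡ d a))
                                  (trans (*-congˡ (J⟨⟩-↑ʳ d a)) (sym (-‿distribʳ-* _ _)))) ⟩
      ω x d                                                                    ∎
      where open Reasoning setoid

    ω-J⟨⟩ : ∀ x d → ω x J⟨ d ⟩ ≈ - (x · d)
    ω-J⟨⟩ x d = begin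
      ω x J⟨ d ⟩
        ≈⟨ ∑-cong k (λ a → +-cong (*-congˡ (J⟨⟩-↑ʳ d a)) (-‿cong (*-congˡ (J⟨⟩-↑ˡ d a)))) ⟩
      ∑ R k (λ a → x (a ↑ˡ k) * - d (a ↑ˡ k) - x (k ↑ʳ a) * d (k ↑ʳ a))
        ≈⟨ ∑-cong k (λ a → negate-sum _ _ _ _) ⟩
      ∑ R k (λ a → - (x (a ↑ˡ k) * d (a ↑ˡ k) + x (k ↑ʳ a) * d (k ↑ʳ a)))
        ≈⟨ sym (-‿distrib-∑ k _) ⟩
      - ∑ R k (λ a → x (a ↑ˡ k) * d (a ↑ˡ k) + x (k ↑ʳ a) * d (k ↑ʳ a))
        ≈⟨ -‿cong (trans (∑-distrib-+ k _ _) (sym (∑-++ k k _))) ⟩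
      - (x · d)                                                                ∎
      where
      open Reasoning setoid
      negate-sum : ∀ a b c e → a * - b - c * e ≈ - (a * b + c * e)
      negate-sum = solve 4 (λ a b c e → a :* (:- b) :- c :* e := :- (a :* b :+ c :* e)) refl

    ω-antisym : ∀ x y → ω x y ≈ - ω y x
    ω-antisym x y = trans (∑-cong k (λ a → swap _ _ _ _)) (sym (-‿distrib-∑ k _))
      where
      swap : ∀ a b c e → a * b - c * e ≈ - (e * c - b * a)
      swap = solve 4 (λ a b c e → a :* b :- c :* e := :- (e :* c :- b :* a)) refl

    ω-J⟨⟩ˡ : ∀ d y → ω J⟨ d ⟩ y ≈ d · y
    ω-J⟨⟩ˡ d y = begin
      ω J⟨ d ⟩ y      ≈⟨ ω-antisym J⟨ d ⟩ y ⟩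
      - ω y J⟨ d ⟩    ≈⟨ -‿cong (ω-J⟨⟩ y d) ⟩
      - - (y · d)     ≈⟨ ⁻¹-involutive _ ⟩
      y · d           ≈⟨ ∑-cong n (λ l → *-comm (y l) (d l)) ⟩
      d · y           ∎
      where open Reasoning setoid

    ω-cong : ∀ {x x′ y y′} → (∀ l → x l ≈ x′ l) → (∀ l → y l ≈ y′ l) → ω x y ≈ ω x′ y′
    ω-cong x≈x′ y≈y′ = ∑-cong k (λ a →
      +-cong (*-cong (x≈x′ _) (y≈y′ _)) (-‿cong (*-cong (x≈x′ _) (y≈y′ _))))

    ω-−-self : ∀ x y → ω x (λ l → y l - x l) ≈ ω x y
    ω-−-self x y = ∑-cong k (λ a → cancel _ _ _ _)
      where
      cancel : ∀ xL yR xR yL → xL * (yR - xR) - xR * (yL - xL) ≈ xL * yR - xR * yL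
      cancel = solve 4 (λ xL yR xR yL → xL :* (yR :- xR) :- xR :* (yL :- xL) := xL :* yR :- xR :* yL) refl

    ω-shear : ∀ x y u a b → ω (λ l → x l + a * u l) (λ l → y l + b * u l) ≈ ω x y + (b * ω x u - a * ω y u)
    ω-shear x y u a b = trans (∑-cong k (λ i → expand _ _ _ _ _ _ a b)) (∑-affine k _ _ _ b a)
      where
      expand : ∀ xL xR yL yR uL uR a b →
               (xL + a * uL) * (yR + b * uR) - (xR + a * uR) * (yL + b * uL)
               ≈ (xL * yR - xR * yL) + (b * (xL * uR - xR * uL) - a * (yL * uR - yR * uL))
      expand = solve 8 (λ xL xR yL yR uL uR a b →
               (xL :+ a :* uL) :* (yR :+ b :* uR) :- (xR :+ a :* uR) :* (yL :+ b :* uL)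
               := (xL :* yR :- xR :* yL) :+ (b :* (xL :* uR :- xR :* uL) :- a :* (yL :* uR :- yR :* uL))) refl

    transvection : Vector Carrier n → Carrier → Matrix R n
    transvection d ρ p q = δ p q + ρ * (J⟨ d ⟩ p * d q)

    ⊙-transvection : ∀ x d ρ q → (x ⊙ transvection d ρ) q ≈ x q + (ρ * ω x d) * d q
    ⊙-transvection x d ρ q = begin
      (x ⊙ transvection d ρ) q                                ≈⟨ ∑-cong n (λ p → distribˡ (x p) _ _) ⟩
      ∑ R n (λ p → x p * δ p q + x p * (ρ * (J⟨ d ⟩ p * d q)))  ≈⟨ ∑-distrib-+ n _ _ ⟩
      (x ⊙ Id) q + ∑ R n (λ p → x p * (ρ * (J⟨ d ⟩ p * d q)))
        ≈⟨ +-cong (∑-δʳ n q x) (∑-cong n (λ p → regroup (x p) ρ (J⟨ d ⟩ p) (d q))) ⟩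
      x q + ∑ R n (λ p → x p * J⟨ d ⟩ p * (ρ * d q))           ≈⟨ +-congˡ (sym (*-distribʳ-∑ n _ _)) ⟩
      x q + x · J⟨ d ⟩ * (ρ * d q)                             ≈⟨ +-congˡ (*-congʳ (·-J⟨⟩ x d)) ⟩
      x q + ω x d * (ρ * d q)                                  ≈⟨ +-congˡ (regroup′ (ω x d) ρ (d q)) ⟩
      x q + (ρ * ω x d) * d q                                  ∎
      where
      open Reasoning setoid
      regroup : ∀ a b c e → a * (b * (c * e)) ≈ a * c * (b * e)
      regroup = solve 4 (λ a b c e → a :* (b :* (c :* e)) := a :* c :* (b :* e)) refl
      regroup′ : ∀ a b c → a * (b * c) ≈ b * a * c
      regroup′ = solve 3 (λ a b c → a :* (b :* c) := b :* a :* c) refl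

    transvection-symplectic : ∀ d ρ → IsSymplectic R k (transvection d ρ)
    transvection-symplectic d ρ p q = begin
      (((T ᵗ) ⊗ J) ⊗ T) p q                                      ≈⟨ ω-columns T p q ⟩
      ω ((T ᵗ) p) ((T ᵗ) q)                                     ≈⟨ ω-cong (column p) (column q) ⟩
      ω (λ m → e p m + (ρ * d p) * u m) (λ m → e q m + (ρ * d q) * u m)
        ≈⟨ ω-shear (e p) (e q) u (ρ * d p) (ρ * d q) ⟩
      ω (e p) (e q) + ((ρ * d q) * ω (e p) u - (ρ * d p) * ω (e q) u)
        ≈⟨ +-cong (ω-basis p q) (+-cong (*-congˡ (ω-e p)) (-‿cong (*-congˡ (ω-e q)))) ⟩
      J p q + ((ρ * d q) * - d p - (ρ * d p) * - d q)          ≈⟨ vanish (J p q) ρ (d p) (d q) ⟩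
      J p q                                                     ∎
      where
      open Reasoning setoid
      T : Matrix R n
      T = transvection d ρ
      u : Vector Carrier n
      u = J⟨ d ⟩
      e : Fin n → Vector Carrier n
      e = Id ᵗ
      column : ∀ p m → (T ᵗ) p m ≈ e p m + (ρ * d p) * u m
      column p m = +-congˡ (solve 3 (λ r v w → r :* (v :* w) := (r :* w) :* v) refl ρ (u m) (d p))
      ω-e : ∀ p → ω (e p) u ≈ - d p
      ω-e p = trans (ω-J⟨⟩ (e p) d) (-‿cong (trans (∑-cong n (λ m → *-congʳ (δ-sym m p))) (∑-δˡ n p d)))
      vanish : ∀ j r a b → j + (r * b * - a - r * a * - b) ≈ j
      vanish = solve 4 (λ j r a b → j :+ (r :* b :* (:- a) :- r :* a :* (:- b)) := j) refl

    ∏-symplectic : ∀ m (F : Fin m → Matrix R n) → (∀ j → IsSymplectic R k (F j)) → IsSymplectic R k (∏ m F)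
    ∏-symplectic zero    F _  = Id-symplectic
    ∏-symplectic (suc m) F sF = ⊗-symplectic (sF zero) (∏-symplectic m (F ∘ suc) (sF ∘ suc))

    -- The first factor moves e_i to J g, the second moves J g to v.
    rowMatrix : Fin n → Vector Carrier n → Vector Carrier n → Carrier → Carrier → Matrix R n
    rowMatrix i g v e w = transvection (λ l → J⟨ g ⟩ l - Id i l) (- e) ⊗ transvection (λ l → v l - J⟨ g ⟩ l) (w * e)

    rowMatrix-symplectic : ∀ i g v e w → IsSymplectic R k (rowMatrix i g v e w)
    rowMatrix-symplectic i g v e w = ⊗-symplectic (transvection-symplectic _ _) (transvection-symplectic _ _)

    module _ {ℓ′} (I : Ideal R ℓ′) where
      open Modulo I

      transvection-≋-Id : ∀ d {ρ} → ρ ∈ I → transvection d ρ ≋M Id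
      transvection-≋-Id d {ρ} ρ∈I p q =
        Ideal.∈-resp I (regroup (δ p q) ρ (J⟨ d ⟩ p * d q)) (Ideal.*-closed I (J⟨ d ⟩ p * d q) ρ∈I)
        where
        regroup : ∀ a r t → t * r ≈ (a + r * t) - a
        regroup = solve 3 (λ a r t → t :* r := (a :+ r :* t) :- a) refl

      transvection-moves : ∀ x y ρ → ρ * ω x y ≋ 1# → ∀ q → (x ⊙ transvection (λ l → y l - x l) ρ) q ≋ y q
      transvection-moves x y ρ ρω≋1 q = begin
        (x ⊙ transvection (λ l → y l - x l) ρ) q          ≈⟨ ≈⇒≋ (⊙-transvection x _ ρ q) ⟩
        x q + (ρ * ω x (λ l → y l - x l)) * (y q - x q)  ≈⟨ ≈⇒≋ (+-congˡ (*-congʳ (*-congˡ (ω-−-self x y)))) ⟩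
        x q + (ρ * ω x y) * (y q - x q)                  ≈⟨ +-cong-≋ ≋-refl (*-cong-≋ ρω≋1 ≋-refl) ⟩
        x q + 1# * (y q - x q)                           ≈⟨ ≈⇒≋ (+-congˡ (*-identityˡ _)) ⟩
        x q + (y q - x q)                                ≈⟨ ≈⇒≋ (solve 2 (λ a b → a :+ (b :- a) := b) refl (x q) (y q)) ⟩
        y q                                              ∎
        where open Reasoning ≋-setoid

      rowMatrix-≋-Id : ∀ i g v {e} w → e ∈ I → rowMatrix i g v e w ≋M Id
      rowMatrix-≋-Id i g v {e} w e∈I p q = ≋-trans
        (⊗-cong-≋ (transvection-≋-Id _ (Ideal.∈-resp I (-1*x≈-x e) (Ideal.*-closed I (- 1#) e∈I)))
                  (transvection-≋-Id _ (Ideal.*-closed I w e∈I)) p q)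
        (≈⇒≋ (⊗-identityˡ Id p q))

      rowMatrix-row : ∀ i g v e w → g i ≈ 1# → (g · v) * w ≋ 1# → e ≋ 1# → ∀ q → rowMatrix i g v e w i q ≋ v q
      rowMatrix-row i g v e w gi≈1 g·v-unit e≋1 q =
        ≋-trans (⊙-cong-≋ T₂ (λ p → ≋-trans (≈⇒≋ (sym (⊗-identityˡ T₁ i p)))
                                             (transvection-moves (Id i) z (- e) first p)) q)
                (transvection-moves z v (w * e) second q)
        where
        z : Vector Carrier n
        z = J⟨ g ⟩
        T₁ T₂ : Matrix R n
        T₁ = transvection (λ l → z l - Id i l) (- e)
        T₂ = transvection (λ l → v l - z l) (w * e)
        first : - e * ω (Id i) z ≋ 1#
        first = begin
          - e * ω (Id i) z    ≈⟨ ≈⇒≋ (*-congˡ (trans (ω-J⟨⟩ (Id i) g) (-‿cong (trans (∑-δˡ n i g) gi≈1)))) ⟩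
          - e * - 1#          ≈⟨ ≈⇒≋ (trans (solve 2 (λ e o → (:- e) :* (:- o) := e :* o) refl e 1#) (*-identityʳ e)) ⟩
          e                   ≈⟨ e≋1 ⟩
          1#                  ∎
          where open Reasoning ≋-setoid
        second : w * e * ω z v ≋ 1#
        second = begin
          w * e * ω z v       ≈⟨ ≈⇒≋ (*-congˡ (ω-J⟨⟩ˡ g v)) ⟩
          w * e * (g · v)     ≈⟨ *-cong-≋ (*-cong-≋ ≋-refl e≋1) ≋-refl ⟩
          w * 1# * (g · v)    ≈⟨ ≈⇒≋ (trans (*-congʳ (*-identityʳ w)) (*-comm w _)) ⟩
          (g · v) * w         ≈⟨ g·v-unit ⟩
          1#                  ∎
          where open Reasoning ≋-setoid

    module _ {ℓ′} (I : Fin n → Ideal R ℓ′) where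
      open Modulo using (_≋_; _≋M_)

      LiftsRow : Fin n → Vector Carrier n → Matrix R n → Set (ℓ ⊔ ℓ′)
      LiftsRow i v E = IsSymplectic R k E × (∀ q → _≋_ (I i) (E i q) (v q)) × (∀ j → j ≢ i → _≋M_ (I j) E Id)

      liftRow : ∀ i (v : Vector Carrier n) →
                (∃ λ e → _≋_ (I i) e 1# × (∀ j → j ≢ i → e ∈ I j)) →
                (∃ λ g → g i ≈ 1# × UnitMod R (Ideal._∈I (I i)) (g · v)) →
                ∃ (LiftsRow i v)
      liftRow i v (e , e≋1 , e∈Iⱼ) (g , gᵢ≈1 , w , g·v-unit) =
        rowMatrix i g v e w ,
        rowMatrix-symplectic i g v e w ,
        rowMatrix-row (I i) i g v e w gᵢ≈1 g·v-unit e≋1 ,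
        λ j j≢i → rowMatrix-≋-Id (I j) i g v w (e∈Iⱼ j j≢i)

      liftRows : (∀ i j → i ≢ j → Comaximal R (I i) (I j)) →
                 (v : Fin n → Vector Carrier n) →
                 (∀ i → ∃ λ g → g i ≈ 1# × UnitMod R (Ideal._∈I (I i)) (g · v i)) →
                 ∃ λ A → IsSymplectic R k A × (∀ i q → _≋_ (I i) (A i q) (v i q))
      liftRows comax v covectors =
        ∏ n E , ∏-symplectic n E (proj₁ ∘ proj₂ ∘ lifted) ,
        λ i q → Modulo.≋-trans (I i) (Modulo.∏-≋-single (I i) n E i (trivial i) i q)
                                     (proj₁ (proj₂ (proj₂ (lifted i))) q)
        where
        lifted : ∀ i → ∃ (LiftsRow i (v i))
        lifted i = liftRow i (v i) (separator I comax i) (covectors i)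
        E : Fin n → Matrix R n
        E = proj₁ ∘ lifted
        trivial : ∀ i j → j ≢ i → _≋M_ (I i) (E j) Id
        trivial i j j≢i = proj₂ (proj₂ (proj₂ (lifted j))) i (j≢i ∘ ≡.sym)

  unitCovector : ∀ {ℓ′ n} (I : Fin n → Ideal R ℓ′) → USC R (ProdMem R I) ⊎ ProdMem R I 1# →
             (v : Vector Carrier n) → Unital R n v →
             ∀ i → ∃ λ g → g i ≈ 1# × UnitMod R (Ideal._∈I (I i)) (g · v)
  unitCovector I (inj₁ usc) v unital i = map₂ (map₂ (map₂ (ProdMem⊆ I i))) (USC⇒unitCovector (prodIdeal I) usc _ v unital i)
  unitCovector I (inj₂ 1∈∏I)  v _      i = Id i , δ-refl i , 1∈⇒UnitMod (I i) (ProdMem⊆ I i 1∈∏I) _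

  pow-1# : ∀ m → pow R 1# m ≈ 1#
  pow-1# zero    = refl
  pow-1# (suc m) = trans (*-identityˡ _) (pow-1# m)

  ≋⇒PFEquiv : ∀ {ℓ′ n} (J : Ideal R ℓ′) (m : Fin n → ℕ) {a b : Vector Carrier n} →
              (∀ q → Modulo._≋_ J (a q) (b q)) → PFEquiv R (Ideal._∈I J) m a b
  ≋⇒PFEquiv J m a≋b = 1# , (1# , ≈⇒≋ (*-identityˡ 1#)) ,
                      λ q → ≋-trans (a≋b q) (≈⇒≋ (sym (trans (*-congʳ (pow-1# (m q))) (*-identityˡ _))))
    where open Modulo J

open import Data.Nat using (_+_)

mainTheorem4 : ∀ {c ℓ ℓ' : Level} (R : CommutativeRing c ℓ) (k : ℕ)
    (I : Fin (k + k) → Ideal R ℓ') →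
    (∀ i j → i ≢ j → Comaximal R (I i) (I j)) →
    (USC R (ProdMem R I) ⊎ ProdMem R I (CommutativeRing.1# R)) →
    (m : Fin (k + k) → Fin (k + k) → ℕ) →
    (v : Fin (k + k) → Fin (k + k) → CommutativeRing.Carrier R) →
    (∀ i → GCDTuple R (k + k) (v i)) →
    ∃ λ (A : Matrix R (k + k)) → IsSymplectic R k A ×
      (∀ i → PFEquiv R (Ideal._∈I (I i)) (m i) (A i) (v i))
mainTheorem4 R k I comax hyp m v gcd =
  map₂ (map₂ (λ A≋v i → ≋⇒PFEquiv R (I i) (m i) (A≋v i)))
       (Symplectic.liftRows R k I comax v (λ i → unitCovector R I hyp (v i) (gcd i) i))
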